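{- Let $(W,S)$ be a Coxeter system, $B$ a Garside shadow in $(W,S)$, and $u,w\in W$. Then: (a) $\pi_B\circ\pi_B=\pi_B$; (b) $\pi_B(w)\le_R w$, with equality if and only if $w\in B$; (c) if $u\le_R w$ then $\pi_B(u)\le_R\pi_B(w)$.
   Context: $\ell$ is the length function. $u$ is a prefix of $w$ if $\ell(w)=\ell(u)+\ell(u^{ -1}w)$; $v$ is a suffix of $w$ if $\ell(w)=\ell(wv^{ -1})+\ell(v)$. The right weak order is $u\le_R w$ iff $u$ is a prefix of $w$; every bounded subset $X$ (one with an upper bound) has a join $\bigvee X$. A Garside shadow is $B\subseteq W$ with $S\subseteq B$, closed under joins of bounded subsets and under taking suffixes. $\pi_B(w)=\bigvee\{g\in B\mid g\le_R w\}$. -}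

module Defs where

open import Data.Nat using (ℕ; zero; suc; _+_; _≤_)
open import Data.Maybe using (Maybe; just; nothing)
open import Data.List using (List; []; _∷_; _++_; length; reverse)
open import Data.Product using (Σ; _×_; _,_)
open import Relation.Binary.PropositionalEquality using (_≡_; _≢_)
open import Function.Bundles using (_⇔_)

-- A Coxeter matrix on a set S of generators: m s t ∈ {1,2,…} ∪ {∞},
-- with ∞ encoded as nothing.  m s s = 1, m symmetric, m s t ≥ 2 for s ≠ t.
record CoxeterMatrix (S : Set) : Set where
  field
    m      : S → S → Maybe ℕ
    diag   : ∀ s → m s s ≡ just 1
    symm   : ∀ s t → m s t ≡ m t s
    offdiag0 : ∀ s t → s ≢ t → m s t ≢ just 0
    offdiag1 : ∀ s t → s ≢ t → m s t ≢ just 1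

-- The Coxeter system (W,S) attached to a Coxeter matrix: W is the
-- group with presentation ⟨S | s² = 1, (st)^{m(s,t)} = 1⟩, realised as
-- words over S modulo the congruence generated by s s = ε and the braid
-- relations sts… = tst… (m(s,t) letters each, for m(s,t) < ∞).
module Coxeter {S : Set} (M : CoxeterMatrix S) where
  open CoxeterMatrix M

  Word : Set
  Word = List S

  alt : S → S → ℕ → Word
  alt s t zero    = []
  alt s t (suc k) = s ∷ alt t s k

  data Rel : Word → Word → Set where
    inv   : ∀ s → Rel (s ∷ s ∷ []) []
    braid : ∀ s t k → m s t ≡ just k → Rel (alt s t k) (alt t s k)

  infix 4 _∼_
  data _∼_ : Word → Word → Set where
    rel   : ∀ u {x y} v → Rel x y → (u ++ x ++ v) ∼ (u ++ y ++ v)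
    ∼refl  : ∀ {x} → x ∼ x
    ∼sym   : ∀ {x y} → x ∼ y → y ∼ x
    ∼trans : ∀ {x y z} → x ∼ y → y ∼ z → x ∼ z

  inverse : Word → Word
  inverse = reverse

  Reduced : Word → Set
  Reduced v = ∀ v' → v' ∼ v → length v ≤ length v'

  Len : Word → ℕ → Set
  Len w n = Σ Word λ v → v ∼ w × Reduced v × length v ≡ n

  infix 4 _≤R_
  _≤R_ : Word → Word → Set
  u ≤R w = Σ ℕ λ a → Σ ℕ λ b → Len u a × Len (inverse u ++ w) b × Len w (a + b)

  IsSuffix : Word → Word → Set
  IsSuffix v w = Σ ℕ λ a → Σ ℕ λ b → Len (w ++ inverse v) a × Len v b × Len w (a + b)

  -- subsets of W are predicates on words (required to respect ∼ where relevant)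
  Subset : Set₁
  Subset = Word → Set

  IsUpperBound : Subset → Word → Set
  IsUpperBound X j = ∀ x → X x → x ≤R j

  Bounded : Subset → Set
  Bounded X = Σ Word λ j → IsUpperBound X j

  IsJoin : Subset → Word → Set
  IsJoin X j = IsUpperBound X j × (∀ k → IsUpperBound X k → j ≤R k)

  record GarsideShadow (B : Subset) : Set₁ where
    field
      respects   : ∀ x y → x ∼ y → B x → B y
      gens       : ∀ s → B (s ∷ [])
      joinClosed : ∀ (X : Subset) → (∀ x → X x → B x) → Bounded X →
                   ∀ j → IsJoin X j → B j
      suffixClosed : ∀ w v → B w → IsSuffix v w → B v

  IsPi : Subset → Word → Word → Set
  IsPi B w p = IsJoin (λ g → B g × g ≤R w) p

-- A set containing an upper
-- bound of itself has that element as its join, which gives (a), and (b) when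
-- w ∈ B; for (c), π_B(u) ≤R u ≤R w puts π_B(u) into B ∩ ↓w.  The only real
-- work is that ≤R is a partial order on W: antisymmetry holds because
-- ℓ(w) = ℓ(u) + ℓ(u⁻¹w) and ℓ(u) = ℓ(w) + ℓ(w⁻¹u) force ℓ(u⁻¹w) = 0.
module Submission where

open import Defs
open import Data.Product using (_×_; _,_; proj₁; proj₂)
open import Function.Bundles using (_⇔_; mk⇔)
open import Data.Nat using (_+_; _≤_; z≤n)
open import Data.Nat.Properties
  using (+-assoc; +-cancelˡ-≡; +-cancelˡ-≤; +-identityʳ; m+n≡0⇒m≡0; ≤-antisym)
open import Data.List using ([]; _∷_; _++_; length; reverse)
open import Data.List.Properties
  using (++-assoc; ++-identityʳ; length-++; unfold-reverse; reverse-involutive)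
open import Relation.Binary.Bundles using (Setoid)
open import Relation.Binary.PropositionalEquality
  using (_≡_; refl; sym; trans; cong; cong₂; subst)

module _ {S : Set} (M : CoxeterMatrix S) where
  open Coxeter M

  ∼-reflexive : ∀ {x y} → x ≡ y → x ∼ y
  ∼-reflexive refl = ∼refl

  ∼-setoid : Setoid _ _
  ∼-setoid = record
    { Carrier       = Word
    ; _≈_           = _∼_
    ; isEquivalence = record { refl = ∼refl ; sym = ∼sym ; trans = ∼trans }
    }

  open import Relation.Binary.Reasoning.Setoid ∼-setoid

  ∼-++ˡ : ∀ a {x y} → x ∼ y → a ++ x ∼ a ++ y
  ∼-++ˡ a (rel u {x} {y} v r) = begin
    a ++ u ++ x ++ v     ≡⟨ ++-assoc a u (x ++ v) ⟨
    (a ++ u) ++ x ++ v   ≈⟨ rel (a ++ u) v r ⟩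
    (a ++ u) ++ y ++ v   ≡⟨ ++-assoc a u (y ++ v) ⟩
    a ++ u ++ y ++ v     ∎
  ∼-++ˡ a ∼refl       = ∼refl
  ∼-++ˡ a (∼sym p)     = ∼sym (∼-++ˡ a p)
  ∼-++ˡ a (∼trans p q) = ∼trans (∼-++ˡ a p) (∼-++ˡ a q)

  ∼-++ʳ : ∀ b {x y} → x ∼ y → x ++ b ∼ y ++ b
  ∼-++ʳ b (rel u {x} {y} v r) = begin
    (u ++ x ++ v) ++ b   ≡⟨ ++-assoc u (x ++ v) b ⟩
    u ++ (x ++ v) ++ b   ≡⟨ cong (u ++_) (++-assoc x v b) ⟩
    u ++ x ++ v ++ b     ≈⟨ rel u (v ++ b) r ⟩
    u ++ y ++ v ++ b     ≡⟨ cong (u ++_) (++-assoc y v b) ⟨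
    u ++ (y ++ v) ++ b   ≡⟨ ++-assoc u (y ++ v) b ⟨
    (u ++ y ++ v) ++ b   ∎
  ∼-++ʳ b ∼refl       = ∼refl
  ∼-++ʳ b (∼sym p)     = ∼sym (∼-++ʳ b p)
  ∼-++ʳ b (∼trans p q) = ∼trans (∼-++ʳ b p) (∼-++ʳ b q)

  ∼-++ : ∀ {x x' y y'} → x ∼ x' → y ∼ y' → x ++ y ∼ x' ++ y'
  ∼-++ {x' = x'} {y = y} p q = ∼trans (∼-++ʳ y p) (∼-++ˡ x' q)

  inverseʳ : ∀ u → u ++ inverse u ∼ []
  inverseʳ []      = ∼refl
  inverseʳ (s ∷ u) = begin
    s ∷ u ++ reverse (s ∷ u)          ≡⟨ cong (λ z → s ∷ u ++ z) (unfold-reverse s u) ⟩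
    s ∷ u ++ reverse u ++ s ∷ []      ≡⟨ cong (s ∷_) (++-assoc u (reverse u) (s ∷ [])) ⟨
    s ∷ (u ++ reverse u) ++ s ∷ []    ≈⟨ ∼-++ˡ (s ∷ []) (∼-++ʳ (s ∷ []) (inverseʳ u)) ⟩
    s ∷ s ∷ []                        ≈⟨ rel [] [] (inv s) ⟩
    []                                ∎

  inverseˡ : ∀ u → inverse u ++ u ∼ []
  inverseˡ u = subst (λ z → reverse u ++ z ∼ []) (reverse-involutive u) (inverseʳ (reverse u))

  ++-inverse-++ : ∀ u w → u ++ (inverse u ++ w) ∼ w
  ++-inverse-++ u w = ∼trans (∼-reflexive (sym (++-assoc u (reverse u) w))) (∼-++ʳ w (inverseʳ u))

  inverse-++-∼[]⇒∼ : ∀ {u w} → inverse u ++ w ∼ [] → u ∼ w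
  inverse-++-∼[]⇒∼ {u} {w} e = begin
    u                        ≡⟨ ++-identityʳ u ⟨
    u ++ []                  ≈⟨ ∼-++ˡ u e ⟨
    u ++ (inverse u ++ w)    ≈⟨ ++-inverse-++ u w ⟩
    w                        ∎

  Len-functional : ∀ {u a a'} → Len u a → Len u a' → a ≡ a'
  Len-functional (v , v∼u , v-red , refl) (v' , v'∼u , v'-red , refl) =
    ≤-antisym (v-red v' (∼trans v'∼u (∼sym v∼u))) (v'-red v (∼trans v∼u (∼sym v'∼u)))

  Len-resp-∼ : ∀ {x y n} → x ∼ y → Len x n → Len y n
  Len-resp-∼ x∼y (v , v∼x , v-red , |v|≡n) =
    v , ∼trans v∼x x∼y , v-red , |v|≡n

  Len-trivial : ∀ {x} → x ∼ [] → Len x 0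
  Len-trivial x∼[] = [] , ∼sym x∼[] , (λ _ _ → z≤n) , refl

  Len-zero⇒∼[] : ∀ {x} → Len x 0 → x ∼ []
  Len-zero⇒∼[] ([] , []∼x , _ , _) = ∼sym []∼x

  Len-++-≤ : ∀ {u v a c} → Len u a → Len (u ++ v) c → ∀ v' → v' ∼ v → c ≤ a + length v'
  Len-++-≤ (r , r∼u , _ , refl) (t , t∼uv , t-red , refl) v' v'∼v =
    subst (length t ≤_) (length-++ r) (t-red (r ++ v') (∼trans (∼-++ r∼u v'∼v) (∼sym t∼uv)))

  -- A word for p⁻¹w of length ℓ(w) − ℓ(p) is reduced, since ℓ(w) ≤ ℓ(p) + ℓ(p⁻¹w).
  Len-quotient : ∀ {p w a n} z → Len p a → Len w (a + n) →
                 z ∼ inverse p ++ w → length z ≡ n → Len (inverse p ++ w) n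
  Len-quotient {p} {w} {a} z Lp Lw z∼ refl = z , z∼ , z-red , refl
    where
    z-red : Reduced z
    z-red v' v'∼z = +-cancelˡ-≤ a _ _
      (Len-++-≤ Lp (Len-resp-∼ (∼sym (++-inverse-++ p w)) Lw) v' (∼trans v'∼z z∼))

  ≤R-refl : ∀ {u a} → Len u a → u ≤R u
  ≤R-refl {u} {a} Lu = a , 0 , Lu , Len-trivial (inverseˡ u) , subst (Len u) (sym (+-identityʳ a)) Lu

  ≤R-reflˡ : ∀ {u w} → u ≤R w → u ≤R u
  ≤R-reflˡ (_ , _ , Lu , _) = ≤R-refl Lu

  ≤R-reflʳ : ∀ {u w} → u ≤R w → w ≤R w
  ≤R-reflʳ (_ , _ , _ , _ , Lw) = ≤R-refl Lw

  ≤R-antisym : ∀ {u w} → u ≤R w → w ≤R u → u ∼ w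
  ≤R-antisym (a , b , Lu , Lu⁻¹w , Lw) (c , d , Lw' , _ , Lu') =
    inverse-++-∼[]⇒∼ (Len-zero⇒∼[] (subst (Len _) b≡0 Lu⁻¹w))
    where
    a+[b+d]≡a+0 : a + (b + d) ≡ a + 0
    a+[b+d]≡a+0 = trans (sym (+-assoc a b d))
      (trans (cong (_+ d) (Len-functional Lw Lw'))
        (trans (Len-functional Lu' Lu) (sym (+-identityʳ a))))
    b≡0 : b ≡ 0
    b≡0 = m+n≡0⇒m≡0 b (+-cancelˡ-≡ a _ _ a+[b+d]≡a+0)

  ≤R-trans : ∀ {p u w} → p ≤R u → u ≤R w → p ≤R w
  ≤R-trans {p} {u} {w} (a , b , Lp , (x , x∼ , _ , |x|≡b) , Lu)
                       (c , d , Lu' , (y , y∼ , _ , |y|≡d) , Lw) =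
    a , b + d , Lp , Len-quotient (x ++ y) Lp Lw' xy∼ |xy|≡b+d , Lw'
    where
    Lw' : Len w (a + (b + d))
    Lw' = subst (Len w) (trans (cong (_+ d) (Len-functional Lu' Lu)) (+-assoc a b d)) Lw
    xy∼ : x ++ y ∼ inverse p ++ w
    xy∼ = begin
      x ++ y                                   ≈⟨ ∼-++ x∼ y∼ ⟩
      (inverse p ++ u) ++ (inverse u ++ w)     ≡⟨ ++-assoc (inverse p) u _ ⟩
      inverse p ++ (u ++ (inverse u ++ w))     ≈⟨ ∼-++ˡ (inverse p) (++-inverse-++ u w) ⟩
      inverse p ++ w                           ∎
    |xy|≡b+d : length (x ++ y) ≡ b + d
    |xy|≡b+d = trans (length-++ x) (cong₂ _+_ |x|≡b |y|≡d)

  IsJoin-greatest : ∀ {X j x} → IsJoin X j → X x → IsUpperBound X x → j ∼ x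
  IsJoin-greatest (j-ub , j-least) x∈X x-ub = ≤R-antisym (j-least _ x-ub) (j-ub _ x∈X)

  module _ {B : Subset} (G : GarsideShadow B) where
    open GarsideShadow G

    IsPi-≤R : ∀ {w p} → IsPi B w p → p ≤R w
    IsPi-≤R (_ , p-least) = p-least _ (λ _ → proj₂)

    IsPi-∈ : ∀ {w p} → IsPi B w p → B p
    IsPi-∈ {w} {p} Pp = joinClosed _ (λ _ → proj₁) (w , λ _ → proj₂) p Pp

    IsPi-idempotent : ∀ {w p q} → IsPi B w p → IsPi B p q → q ∼ p
    IsPi-idempotent Pp Pq = IsJoin-greatest Pq (IsPi-∈ Pp , ≤R-reflˡ (IsPi-≤R Pp)) (λ _ → proj₂)

    IsPi-∼⇔∈ : ∀ {w p} → IsPi B w p → (p ∼ w ⇔ B w)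
    IsPi-∼⇔∈ {w} {p} Pp = mk⇔
      (λ p∼w → respects p w p∼w (IsPi-∈ Pp))
      (λ w∈B → IsJoin-greatest Pp (w∈B , ≤R-reflʳ (IsPi-≤R Pp)) (λ _ → proj₂))

    IsPi-monotone : ∀ {u w p q} → u ≤R w → IsPi B u p → IsPi B w q → p ≤R q
    IsPi-monotone u≤w Pp (q-ub , _) = q-ub _ (IsPi-∈ Pp , ≤R-trans (IsPi-≤R Pp) u≤w)

proposition2p5 : {S : Set} (M : CoxeterMatrix S) (B : Coxeter.Subset M) →
    Coxeter.GarsideShadow M B →
    ((w p q : Coxeter.Word M) → Coxeter.IsPi M B w p → Coxeter.IsPi M B p q →
    Coxeter._∼_ M q p)
    × ((w p : Coxeter.Word M) → Coxeter.IsPi M B w p →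
    Coxeter._≤R_ M p w × (Coxeter._∼_ M p w ⇔ B w))
    × ((u w p q : Coxeter.Word M) → Coxeter._≤R_ M u w →
    Coxeter.IsPi M B u p → Coxeter.IsPi M B w q → Coxeter._≤R_ M p q)
proposition2p5 M B G =
    (λ _ _ _ → IsPi-idempotent M G)
  , (λ _ _ Pp → IsPi-≤R M G Pp , IsPi-∼⇔∈ M G Pp)
  , (λ _ _ _ _ → IsPi-monotone M G)
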